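{- Let $\mathbf{A}$ be a De Morgan monoid that is finitely subdirectly irreducible and not idempotent, and let $a,b\in A$ with $f\leqslant a$ and $f\leqslant b$. Then $a\cdot b=f^2$ if $a,b\leqslant f^2$, and $a\cdot b=\max_{\leqslant}\{a,b\}$ otherwise (in which case $a$ and $b$ are comparable). If, moreover, $a<b$ and $f^2\leqslant b$, then $a\cdot\neg b=\neg b=b\cdot\neg b$ and $b\cdot\neg a=b$.
   Context: An involutive (commutative) residuated lattice (IRL) is an algebra $\langle A;\cdot,\wedge,\vee,\neg,e\rangle$ such that $\langle A;\cdot,e\rangle$ is a commutative monoid, $\langle A;\wedge,\vee\rangle$ is a lattice with order $\leqslant$, $\neg\neg x=x$, and $x\cdot y\leqslant z\iff \neg z\cdot y\leqslant\neg x$. Write $f:=\neg e$, $x^2:=x\cdot x$. A De Morgan monoid is an IRL with distributive lattice reduct satisfying $x\leqslant x^2$. An algebra is idempotent if $x^2=x$ for all its elements. An algebra is finitely subdirectly irreducible if its identity relation is meet-irreducible in its congruence lattice. -}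

module Defs where

open import Data.Product using (_×_; _,_)
open import Data.Sum using (_⊎_)
open import Relation.Nullary using (¬_)
open import Relation.Binary.PropositionalEquality using (_≡_; _≢_)

-- Involutive commutative residuated lattices, with propositional equality
-- on the carrier.
record IRL : Set₁ where
  infixl 7 _·_
  infixr 6 _∧_ _∨_
  infix 4 _≤_
  field
    Carrier : Set
    _·_ : Carrier → Carrier → Carrier
    _∧_ : Carrier → Carrier → Carrier
    _∨_ : Carrier → Carrier → Carrier
    ∼   : Carrier → Carrier
    e   : Carrier
  _≤_ : Carrier → Carrier → Set
  x ≤ y = x ∧ y ≡ x
  field
    ·-assoc : ∀ x y z → (x · y) · z ≡ x · (y · z)
    ·-comm  : ∀ x y → x · y ≡ y · x
    ·-idˡ   : ∀ x → e · x ≡ x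
    ∧-assoc : ∀ x y z → (x ∧ y) ∧ z ≡ x ∧ (y ∧ z)
    ∨-assoc : ∀ x y z → (x ∨ y) ∨ z ≡ x ∨ (y ∨ z)
    ∧-comm  : ∀ x y → x ∧ y ≡ y ∧ x
    ∨-comm  : ∀ x y → x ∨ y ≡ y ∨ x
    ∧-absorbs-∨ : ∀ x y → x ∧ (x ∨ y) ≡ x
    ∨-absorbs-∧ : ∀ x y → x ∨ (x ∧ y) ≡ x
    ∼∼ : ∀ x → ∼ (∼ x) ≡ x
    resid→ : ∀ x y z → x · y ≤ z → ∼ z · y ≤ ∼ x
    resid← : ∀ x y z → ∼ z · y ≤ ∼ x → x · y ≤ z

module _ (A : IRL) where
  open IRL A

  f : Carrier
  f = ∼ e

  _² : Carrier → Carrier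
  x ² = x · x

  _<_ : Carrier → Carrier → Set
  x < y = x ≤ y × x ≢ y

  IsDeMorganMonoid : Set
  IsDeMorganMonoid =
    (∀ x y z → x ∧ (y ∨ z) ≡ (x ∧ y) ∨ (x ∧ z)) × (∀ x → x ≤ x ²)

  IsIdempotent : Set
  IsIdempotent = ∀ x → x ² ≡ x

  record Congruence : Set₁ where
    field
      R : Carrier → Carrier → Set
      refl  : ∀ x → R x x
      sym   : ∀ {x y} → R x y → R y x
      trans : ∀ {x y z} → R x y → R y z → R x z
      ·-cong : ∀ {x x′ y y′} → R x x′ → R y y′ → R (x · y) (x′ · y′)
      ∧-cong : ∀ {x x′ y y′} → R x x′ → R y y′ → R (x ∧ y) (x′ ∧ y′)
      ∨-cong : ∀ {x x′ y y′} → R x x′ → R y y′ → R (x ∨ y) (x′ ∨ y′)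
      ∼-cong : ∀ {x x′} → R x x′ → R (∼ x) (∼ x′)

  IsIdentity : Congruence → Set
  IsIdentity θ = ∀ x y → Congruence.R θ x y → x ≡ y

  IsFSI : Set₁
  IsFSI = (θ ψ : Congruence) →
    (∀ x y → Congruence.R θ x y → Congruence.R ψ x y → x ≡ y) →
    IsIdentity θ ⊎ IsIdentity ψ

module Submission where

open import Defs
open import Data.Product using (_×_; _,_; proj₁; proj₂; map₂)
open import Data.Sum as Sum using (_⊎_; inj₁; inj₂)
open import Function using (id; _∘_)
open import Data.Empty using (⊥-elim)
open import Relation.Nullary using (¬_)
open import Relation.Binary.PropositionalEquality as ≡
  using (_≡_; _≢_; cong; cong₂)
open import Relation.Binary.Bundles using (Poset)
open import Algebra.Bundles using (CommutativeSemigroup)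
open import Algebra.Lattice.Bundles using (Lattice)
import Algebra.Lattice.Properties.Lattice as LatticeProperties
import Algebra.Properties.CommutativeSemigroup as CommutativeSemigroupProperties
import Relation.Binary.Lattice.Bundles as OrderLattice
import Relation.Binary.Reasoning.PartialOrder as PartialOrderReasoning

-- Finite subdirect irreducibility is used only through the dichotomy
--   x ≤ y  or  e ≤ x · ¬y   (FSIDeMorganMonoid.dichotomy).
-- For an idempotent c ≤ e the relation  c · x = c · y  is a congruence; when
-- (e ∧ p) ∨ (e ∧ q) = e two such congruences meet in the identity, so FSI
-- makes e join-prime, and applied to  e ≤ x ∨ ¬x  this yields  e ≤ x  or
-- x ≤ f.  Square-increasingness alone gives f³ ≤ f², and non-idempotence
-- gives f² ≰ f, hence e ≤ f².  From these, every x ≥ f² satisfies x · f = x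
-- and x² = x and is comparable with every element; the three claims of the
-- theorem then follow by short order-theoretic arguments.

module IRLProperties (A : IRL) where
  open IRL A

  -- f² = f · f, definitionally the  _² A (f A)  of the theorem.
  f² : Carrier
  f² = f A · f A

  -- The residual  x ⇒ y = ¬(x · ¬y), right adjoint of  x · _.
  _⇒_ : Carrier → Carrier → Carrier
  x ⇒ y = ∼ (x · ∼ y)

  -- The lattice reduct as a library lattice; its order  x ≡ x ∧ y  is the
  -- symmetric form of ours, so the order-theoretic facts transfer by  sym.
  lattice : Lattice _ _
  lattice = record
    { Carrier = Carrier ; _≈_ = _≡_ ; _∨_ = _∨_ ; _∧_ = _∧_
    ; isLattice = record
      { isEquivalence = ≡.isEquivalence
      ; ∨-comm = ∨-comm ; ∨-assoc = ∨-assoc ; ∨-cong = cong₂ _∨_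
      ; ∧-comm = ∧-comm ; ∧-assoc = ∧-assoc ; ∧-cong = cong₂ _∧_
      ; absorptive = ∨-absorbs-∧ , ∧-absorbs-∨ } }

  private
    module L = OrderLattice.Lattice (LatticeProperties.∨-∧-orderTheoreticLattice lattice)

  ≤-refl : ∀ {x} → x ≤ x
  ≤-refl = ≡.sym L.refl

  ≤-reflexive : ∀ {x y} → x ≡ y → x ≤ y
  ≤-reflexive ≡.refl = ≤-refl

  ≤-trans : ∀ {x y z} → x ≤ y → y ≤ z → x ≤ z
  ≤-trans p q = ≡.sym (L.trans (≡.sym p) (≡.sym q))

  ≤-antisym : ∀ {x y} → x ≤ y → y ≤ x → x ≡ y
  ≤-antisym p q = L.antisym (≡.sym p) (≡.sym q)

  x≤x∨y : ∀ x y → x ≤ x ∨ y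
  x≤x∨y x y = ≡.sym (L.x≤x∨y x y)

  y≤x∨y : ∀ x y → y ≤ x ∨ y
  y≤x∨y x y = ≡.sym (L.y≤x∨y x y)

  ∨-least : ∀ {x y z} → x ≤ z → y ≤ z → x ∨ y ≤ z
  ∨-least p q = ≡.sym (L.∨-least (≡.sym p) (≡.sym q))

  x∧y≤x : ∀ x y → x ∧ y ≤ x
  x∧y≤x x y = ≡.sym (L.x∧y≤x x y)

  x∧y≤y : ∀ x y → x ∧ y ≤ y
  x∧y≤y x y = ≡.sym (L.x∧y≤y x y)

  ∧-greatest : ∀ {x y z} → x ≤ y → x ≤ z → x ≤ y ∧ z
  ∧-greatest p q = ≡.sym (L.∧-greatest (≡.sym p) (≡.sym q))

  ≤-poset : Poset _ _ _
  ≤-poset = record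
    { Carrier = Carrier ; _≈_ = _≡_ ; _≤_ = _≤_
    ; isPartialOrder = record
      { isPreorder = record
        { isEquivalence = ≡.isEquivalence ; reflexive = ≤-reflexive ; trans = ≤-trans }
      ; antisym = ≤-antisym } }

  module ≤-Reasoning = PartialOrderReasoning ≤-poset

  ·-commutativeSemigroup : CommutativeSemigroup _ _
  ·-commutativeSemigroup = record
    { Carrier = Carrier ; _≈_ = _≡_ ; _∙_ = _·_
    ; isCommutativeSemigroup = record
      { isSemigroup = record
        { isMagma = record { isEquivalence = ≡.isEquivalence ; ∙-cong = cong₂ _·_ }
        ; assoc = ·-assoc }
      ; comm = ·-comm } }

  open CommutativeSemigroupProperties ·-commutativeSemigroup public
    using (interchange; x∙yz≈y∙xz; xy∙z≈xz∙y; xy∙z≈y∙xz)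

  ·-idʳ : ∀ x → x · e ≡ x
  ·-idʳ x = ≡.trans (·-comm x e) (·-idˡ x)

  -- The involution turns  x · y ≤ ¬z  into a condition symmetric in x, y, z.
  ∼-rotate : ∀ {x y z} → x · y ≤ ∼ z → z · y ≤ ∼ x
  ∼-rotate {x} {y} {z} p = ≡.subst (λ w → w · y ≤ ∼ x) (∼∼ z) (resid→ x y (∼ z) p)

  ∼-swap : ∀ {x y z} → x · y ≤ ∼ z → x · z ≤ ∼ y
  ∼-swap {x} {y} {z} p =
    ≡.subst (_≤ ∼ y) (·-comm z x) (∼-rotate (≡.subst (_≤ ∼ z) (·-comm x y) p))

  ≤∼⇒·≤f : ∀ {x y} → x ≤ ∼ y → x · y ≤ f A
  ≤∼⇒·≤f {x} {y} p = ∼-swap (≡.subst (_≤ ∼ y) (≡.sym (·-idʳ x)) p)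

  ·≤f⇒≤∼ : ∀ {x y} → x · y ≤ f A → x ≤ ∼ y
  ·≤f⇒≤∼ {x} {y} p = ≡.subst (_≤ ∼ y) (·-idʳ x) (∼-swap p)

  ∼-galois : ∀ {x y} → x ≤ ∼ y → y ≤ ∼ x
  ∼-galois {x} {y} p = ·≤f⇒≤∼ (≡.subst (_≤ f A) (·-comm x y) (≤∼⇒·≤f p))

  ∼-antitone : ∀ {x y} → x ≤ y → ∼ y ≤ ∼ x
  ∼-antitone {x} {y} p = ∼-galois (≡.subst (x ≤_) (≡.sym (∼∼ y)) p)

  residuation : ∀ {x y z} → x · y ≤ z → y ≤ x ⇒ z
  residuation {x} {y} {z} p = ∼-galois (∼-swap (≡.subst (x · y ≤_) (≡.sym (∼∼ z)) p))

  residuation⁻¹ : ∀ {x y z} → y ≤ x ⇒ z → x · y ≤ z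
  residuation⁻¹ {x} {y} {z} p = ≡.subst (x · y ≤_) (∼∼ z) (∼-swap (∼-galois p))

  modus-ponens : ∀ x y → x · (x ⇒ y) ≤ y
  modus-ponens x y = residuation⁻¹ ≤-refl

  x·∼x≤f : ∀ x → x · ∼ x ≤ f A
  x·∼x≤f x = ≤∼⇒·≤f (≤-reflexive (≡.sym (∼∼ x)))

  ·-monoʳ : ∀ {x y z} → x ≤ y → z · x ≤ z · y
  ·-monoʳ {x} {y} {z} p = residuation⁻¹ (≤-trans p (residuation ≤-refl))

  ·-monoˡ : ∀ {x y z} → x ≤ y → x · z ≤ y · z
  ·-monoˡ {x} {y} {z} p = ≡.subst₂ _≤_ (·-comm z x) (·-comm z y) (·-monoʳ p)

  ·-mono : ∀ {x x′ y y′} → x ≤ x′ → y ≤ y′ → x · y ≤ x′ · y′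
  ·-mono p q = ≤-trans (·-monoˡ p) (·-monoʳ q)

  ·-distribˡ-∨ : ∀ x y z → x · (y ∨ z) ≡ x · y ∨ x · z
  ·-distribˡ-∨ x y z = ≤-antisym
    (residuation⁻¹ (∨-least (residuation (x≤x∨y _ _)) (residuation (y≤x∨y _ _))))
    (∨-least (·-monoʳ (x≤x∨y y z)) (·-monoʳ (y≤x∨y y z)))

  ·-below-e : ∀ {c} x → c ≤ e → c · x ≤ x
  ·-below-e {c} x p = ≡.subst (c · x ≤_) (·-idˡ x) (·-monoˡ p)

  ∼-below-e : ∀ {x} → f A ≤ x → ∼ x ≤ e
  ∼-below-e p = ≡.subst (_ ≤_) (∼∼ e) (∼-antitone p)

  ·f≤f⇒≤e : ∀ {p} → p · f A ≤ f A → p ≤ e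
  ·f≤f⇒≤e p = ≡.subst (_ ≤_) (∼∼ e) (·≤f⇒≤∼ p)

  ·∼-shrinks : ∀ {a b} → a · b ≤ b → a · ∼ b ≤ ∼ b
  ·∼-shrinks {a} {b} p = ·≤f⇒≤∼ (begin
    (a · ∼ b) · b  ≡⟨ xy∙z≈xz∙y a (∼ b) b ⟩
    (a · b) · ∼ b  ≤⟨ ·-monoˡ p ⟩
    b · ∼ b        ≤⟨ x·∼x≤f b ⟩
    f A            ∎)
    where open ≤-Reasoning

  ∼-∧ : ∀ x y → ∼ (x ∧ y) ≤ ∼ x ∨ ∼ y
  ∼-∧ x y = ≡.subst (_ ≤_) (∼∼ _)
    (∼-antitone (∧-greatest (lower (x≤x∨y _ _)) (lower (y≤x∨y _ _))))
    where
      lower : ∀ {z} → ∼ z ≤ ∼ x ∨ ∼ y → ∼ (∼ x ∨ ∼ y) ≤ z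
      lower p = ≡.subst (_ ≤_) (∼∼ _) (∼-antitone p)

  ·-distribʳ-∨ : ∀ x y z → (y ∨ z) · x ≡ y · x ∨ z · x
  ·-distribʳ-∨ x y z =
    ≡.trans (·-comm (y ∨ z) x) (≡.trans (·-distribˡ-∨ x y z) (cong₂ _∨_ (·-comm x y) (·-comm x z)))

  join-to-e-separates : ∀ {c₁ c₂} → c₁ ∨ c₂ ≡ e →
    ∀ {x y} → c₁ · x ≡ c₁ · y → c₂ · x ≡ c₂ · y → x ≡ y
  join-to-e-separates {c₁} {c₂} cover {x} {y} p q = begin
    x                  ≡⟨ ≡.sym (·-idˡ x) ⟩
    e · x              ≡⟨ cong (_· x) (≡.sym cover) ⟩
    (c₁ ∨ c₂) · x      ≡⟨ ·-distribʳ-∨ x c₁ c₂ ⟩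
    c₁ · x ∨ c₂ · x    ≡⟨ cong₂ _∨_ p q ⟩
    c₁ · y ∨ c₂ · y    ≡⟨ ≡.sym (·-distribʳ-∨ y c₁ c₂) ⟩
    (c₁ ∨ c₂) · y      ≡⟨ cong (_· y) cover ⟩
    e · y              ≡⟨ ·-idˡ y ⟩
    y                  ∎
    where open ≡.≡-Reasoning

module MultiplierCongruence (A : IRL) (c : IRL.Carrier A)
    (c-idem : IRL._·_ A c c ≡ c) (c≤e : IRL._≤_ A c (IRL.e A)) where
  open IRL A
  open IRLProperties A

  Related : Carrier → Carrier → Set
  Related x y = c · x ≡ c · y

  c·-distrib : ∀ x y → c · (x · y) ≡ (c · x) · (c · y)
  c·-distrib x y = ≡.trans (cong (_· (x · y)) (≡.sym c-idem)) (interchange c c x y)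

  saturate : ∀ {x y} → c · x ≤ y → c · x ≤ c · y
  saturate {x} {y} p =
    ≡.subst (_≤ c · y) (≡.trans (≡.sym (·-assoc c c x)) (cong (_· x) c-idem)) (·-monoʳ p)

  Related⇒≤ : ∀ {x x′} → Related x x′ → c · x ≤ x′
  Related⇒≤ {x′ = x′} p = ≡.subst (_≤ x′) (≡.sym p) (·-below-e x′ c≤e)

  ∧-step : ∀ {x x′ y y′} → Related x x′ → Related y y′ → c · (x ∧ y) ≤ c · (x′ ∧ y′)
  ∧-step {x} {x′} {y} {y′} p q = saturate (∧-greatest
    (≤-trans (·-monoʳ (x∧y≤x x y)) (Related⇒≤ p))
    (≤-trans (·-monoʳ (x∧y≤y x y)) (Related⇒≤ q)))

  ∼-step : ∀ {x x′} → Related x x′ → c · ∼ x ≤ c · ∼ x′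
  ∼-step {x} {x′} p = saturate (·≤f⇒≤∼ (begin
    (c · ∼ x) · x′  ≡⟨ xy∙z≈y∙xz c (∼ x) x′ ⟩
    ∼ x · (c · x′)  ≡⟨ cong (∼ x ·_) (≡.sym p) ⟩
    ∼ x · (c · x)   ≤⟨ ·-monoʳ (·-below-e x c≤e) ⟩
    ∼ x · x         ≡⟨ ·-comm (∼ x) x ⟩
    x · ∼ x         ≤⟨ x·∼x≤f x ⟩
    f A             ∎))
    where open ≤-Reasoning

  congruence : Congruence A
  congruence = record
    { R = Related
    ; refl = λ _ → ≡.refl
    ; sym = ≡.sym
    ; trans = ≡.trans
    ; ·-cong = λ {x} {x′} {y} {y′} p q →
        ≡.trans (c·-distrib x y) (≡.trans (cong₂ _·_ p q) (≡.sym (c·-distrib x′ y′)))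
    ; ∧-cong = λ p q → ≤-antisym (∧-step p q) (∧-step (≡.sym p) (≡.sym q))
    ; ∨-cong = λ {x} {x′} {y} {y′} p q →
        ≡.trans (·-distribˡ-∨ c x y) (≡.trans (cong₂ _∨_ p q) (≡.sym (·-distribˡ-∨ c x′ y′)))
    ; ∼-cong = λ p → ≤-antisym (∼-step p) (∼-step (≡.sym p))
    }

  trivial⇒c≡e : IsIdentity A congruence → c ≡ e
  trivial⇒c≡e trivial = trivial c e (≡.trans c-idem (≡.sym (·-idʳ c)))

module SquareIncreasing (A : IRL) (x≤x² : ∀ x → IRL._≤_ A x (IRL._·_ A x x)) where
  open IRL A
  open IRLProperties A

  idempotent-below-e : ∀ {c} → c ≤ e → c · c ≡ c
  idempotent-below-e {c} p = ≤-antisym (≡.subst (c · c ≤_) (·-idʳ c) (·-monoʳ p)) (x≤x² c)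

  -- An element above f that absorbs f is idempotent: the product  c · ¬c
  -- lies below e, hence is idempotent, which yields  c² · ¬c ≤ f.
  idempotent-if-absorbs-f : ∀ {c} → f A ≤ c → c · f A ≤ c → c · c ≡ c
  idempotent-if-absorbs-f {c} f≤c cf≤c = ≤-antisym c²≤c (x≤x² c)
    where
      open ≤-Reasoning
      c∼c≤e : c · ∼ c ≤ e
      c∼c≤e = ·f≤f⇒≤e (begin
        (c · ∼ c) · f A  ≡⟨ xy∙z≈xz∙y c (∼ c) (f A) ⟩
        (c · f A) · ∼ c  ≤⟨ ·-monoˡ cf≤c ⟩
        c · ∼ c          ≤⟨ x·∼x≤f c ⟩
        f A              ∎)
      c∼c≡c²∼c : c · ∼ c ≡ (c · c) · ∼ c
      c∼c≡c²∼c = begin-equality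
        c · ∼ c                  ≡⟨ ≡.sym (idempotent-below-e c∼c≤e) ⟩
        (c · ∼ c) · (c · ∼ c)    ≡⟨ interchange c (∼ c) c (∼ c) ⟩
        (c · c) · (∼ c · ∼ c)    ≡⟨ cong ((c · c) ·_) (idempotent-below-e (∼-below-e f≤c)) ⟩
        (c · c) · ∼ c            ∎
      c²≤c : c · c ≤ c
      c²≤c = ≡.subst (c · c ≤_) (∼∼ c)
        (·≤f⇒≤∼ (≡.subst (_≤ f A) c∼c≡c²∼c (x·∼x≤f c)))

  f²≤f⇒idempotent : f² ≤ f A → IsIdempotent A
  f²≤f⇒idempotent f²≤f x = ≤-antisym (≡.subst (x · x ≤_) (∼∼ x) (·≤f⇒≤∼ (begin
    (x · x) · ∼ x            ≤⟨ ·-monoʳ (x≤x² (∼ x)) ⟩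
    (x · x) · (∼ x · ∼ x)    ≡⟨ interchange x x (∼ x) (∼ x) ⟩
    (x · ∼ x) · (x · ∼ x)    ≤⟨ ·-mono (x·∼x≤f x) (x·∼x≤f x) ⟩
    f²                       ≤⟨ f²≤f ⟩
    f A                      ∎))) (x≤x² x)
    where open ≤-Reasoning

  -- f³ ≤ f².  With  u = ¬f² ≤ e,  the element  f·u  lies below e, so it is
  -- idempotent, giving  f·u = f²·u;  then  f³·u = f·(f·u) ≤ f.
  f²·f≤f² : f² · f A ≤ f²
  f²·f≤f² = ≡.subst (f² · f A ≤_) (∼∼ f²) (·≤f⇒≤∼ (begin
    (f² · f A) · u    ≡⟨ cong (_· u) (·-comm f² (f A)) ⟩
    (f A · f²) · u    ≡⟨ ·-assoc (f A) f² u ⟩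
    f A · (f² · u)    ≡⟨ cong (f A ·_) (≡.sym fu≡f²u) ⟩
    f A · (f A · u)   ≤⟨ ·-monoʳ fu≤e ⟩
    f A · e           ≡⟨ ·-idʳ (f A) ⟩
    f A               ∎))
    where
      open ≤-Reasoning
      u : Carrier
      u = ∼ f²
      fu≤e : f A · u ≤ e
      fu≤e = ·f≤f⇒≤e (≡.subst (_≤ f A) (≡.sym (xy∙z≈xz∙y (f A) u (f A))) (x·∼x≤f f²))
      fu≡f²u : f A · u ≡ f² · u
      fu≡f²u = begin-equality
        f A · u                  ≡⟨ ≡.sym (idempotent-below-e fu≤e) ⟩
        (f A · u) · (f A · u)    ≡⟨ interchange (f A) u (f A) u ⟩
        f² · (u · u)             ≡⟨ cong (f² ·_) (idempotent-below-e (∼-below-e (x≤x² (f A)))) ⟩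
        f² · u                   ∎

  f²-idempotent : f² · f² ≡ f²
  f²-idempotent = idempotent-if-absorbs-f (x≤x² (f A)) f²·f≤f²

module FSIDeMorganMonoid (A : IRL) (dm : IsDeMorganMonoid A) (fsi : IsFSI A) where
  open IRL A
  open IRLProperties A
  open SquareIncreasing A (proj₂ dm)

  -- For  c₁ = e ∧ p  and  c₂ = e ∧ q,  distributivity gives
  -- c₁ ∨ c₂ = e, so the multiplier congruences of c₁ and c₂ meet in the
  -- identity; by FSI one of them is the identity, i.e.  c₁ = e  or  c₂ = e.
  e-join-prime : ∀ {p q} → e ≤ p ∨ q → e ≤ p ⊎ e ≤ q
  e-join-prime {p} {q} e≤p∨q = Sum.map (e≤ p ∘ Θp.trivial⇒c≡e) (e≤ q ∘ Θq.trivial⇒c≡e)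
    (fsi Θp.congruence Θq.congruence (λ _ _ → join-to-e-separates cover))
    where
      module Θp = MultiplierCongruence A (e ∧ p) (idempotent-below-e (x∧y≤x e p)) (x∧y≤x e p)
      module Θq = MultiplierCongruence A (e ∧ q) (idempotent-below-e (x∧y≤x e q)) (x∧y≤x e q)
      cover : (e ∧ p) ∨ (e ∧ q) ≡ e
      cover = ≡.trans (≡.sym (proj₁ dm e p q)) e≤p∨q
      e≤ : ∀ r → e ∧ r ≡ e → e ≤ r
      e≤ r e∧r≡e = ≡.subst (_≤ r) e∧r≡e (x∧y≤y e r)

  -- Every element is above e or below f:  x ∧ ¬x ≤ (x ∧ ¬x)² ≤ x · ¬x ≤ f,
  -- hence  e ≤ ¬(x ∧ ¬x) ≤ x ∨ ¬x,  and e is join-prime.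
  e≤-or-≤f : ∀ x → e ≤ x ⊎ x ≤ f A
  e≤-or-≤f x = Sum.map id ∼-galois (e-join-prime e≤x∨∼x)
    where
      open ≤-Reasoning
      meet≤f : x ∧ ∼ x ≤ f A
      meet≤f = begin
        x ∧ ∼ x                  ≤⟨ proj₂ dm (x ∧ ∼ x) ⟩
        (x ∧ ∼ x) · (x ∧ ∼ x)    ≤⟨ ·-mono (x∧y≤x x (∼ x)) (x∧y≤y x (∼ x)) ⟩
        x · ∼ x                  ≤⟨ x·∼x≤f x ⟩
        f A                      ∎
      e≤x∨∼x : e ≤ x ∨ ∼ x
      e≤x∨∼x = begin
        e                ≤⟨ ∼-galois meet≤f ⟩
        ∼ (x ∧ ∼ x)      ≤⟨ ∼-∧ x (∼ x) ⟩
        ∼ x ∨ ∼ (∼ x)    ≡⟨ cong (∼ x ∨_) (∼∼ x) ⟩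
        ∼ x ∨ x          ≡⟨ ∨-comm (∼ x) x ⟩
        x ∨ ∼ x          ∎

  -- The basic dichotomy, obtained by applying  e≤-or-≤f  to  x ⇒ y:
  -- either  x ≤ y,  or  e ≤ x · ¬y.
  dichotomy : ∀ x y → x ≤ y ⊎ e ≤ x · ∼ y
  dichotomy x y = Sum.map
    (λ e≤x⇒y → ≡.subst (_≤ y) (·-idʳ x) (residuation⁻¹ e≤x⇒y))
    (λ x⇒y≤f → ≡.subst (e ≤_) (∼∼ (x · ∼ y)) (∼-galois x⇒y≤f))
    (e≤-or-≤f (x ⇒ y))

  ≤-if-e≤·∼ : ∀ {x y} → y · f A ≤ y → e ≤ y · ∼ x → x ≤ y
  ≤-if-e≤·∼ {x} {y} yf≤y e≤y∼x = begin
    x                ≡⟨ ≡.sym (·-idʳ x) ⟩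
    x · e            ≤⟨ ·-monoʳ e≤y∼x ⟩
    x · (y · ∼ x)    ≡⟨ x∙yz≈y∙xz x y (∼ x) ⟩
    y · (x · ∼ x)    ≤⟨ ·-monoʳ (x·∼x≤f x) ⟩
    y · f A          ≤⟨ yf≤y ⟩
    y                ∎
    where open ≤-Reasoning

  comparable-if-absorbs-f : ∀ {b} → b · f A ≤ b → ∀ a → a ≤ b ⊎ b ≤ a
  comparable-if-absorbs-f {b} bf≤b a = Sum.swap (Sum.map id (≤-if-e≤·∼ bf≤b) (dichotomy b a))

module NonIdempotentFSI (A : IRL) (dm : IsDeMorganMonoid A) (fsi : IsFSI A)
    (non-idempotent : ¬ IsIdempotent A) where
  open IRL A
  open IRLProperties A
  open SquareIncreasing A (proj₂ dm)
  open FSIDeMorganMonoid A dm fsi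

  f≤f² : f A ≤ f²
  f≤f² = proj₂ dm (f A)

  f²≰f : ¬ (f² ≤ f A)
  f²≰f = non-idempotent ∘ f²≤f⇒idempotent

  e≤f² : e ≤ f²
  e≤f² = Sum.[ id , ⊥-elim ∘ f²≰f ]′ (e≤-or-≤f f²)

  ∼f²≤e : ∼ f² ≤ e
  ∼f²≤e = ∼-below-e f≤f²

  -- cut x = x · ¬f²  lies below x and absorbs f (since  f · ¬f² ≤ ¬f²  by f³ ≤ f²).
  cut : Carrier → Carrier
  cut x = x · ∼ f²

  cut≤ : ∀ x → cut x ≤ x
  cut≤ x = ≡.subst (cut x ≤_) (·-idʳ x) (·-monoʳ ∼f²≤e)

  cut-absorbs-f : ∀ x → cut x · f A ≤ cut x
  cut-absorbs-f x = begin
    (x · ∼ f²) · f A    ≡⟨ ·-assoc x (∼ f²) (f A) ⟩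
    x · (∼ f² · f A)    ≡⟨ cong (x ·_) (·-comm (∼ f²) (f A)) ⟩
    x · (f A · ∼ f²)    ≤⟨ ·-monoʳ (·∼-shrinks (≡.subst (_≤ f²) (·-comm f² (f A)) f²·f≤f²)) ⟩
    x · ∼ f²            ∎
    where open ≤-Reasoning

  -- If e ≤ cut x, then cut x is an idempotent absorbing f, and it equals x:
  -- otherwise the dichotomy gives  e ≤ x · ¬(cut x),  which squeezes cut x
  -- to f², and then  f² = f² · ¬f² ≤ f,  a contradiction.
  cut-collapse : ∀ {x} → e ≤ cut x → x ≤ cut x
  cut-collapse {x} e≤c = Sum.[ id , ⊥-elim ∘ f²≰f ∘ f²≤f ]′ (dichotomy x c)
    where
      open ≤-Reasoning
      c : Carrier
      c = cut x
      f≤c : f A ≤ c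
      f≤c = ≤-trans (≡.subst (_≤ c · f A) (·-idˡ (f A)) (·-monoˡ e≤c)) (cut-absorbs-f x)
      c-idem : c · c ≡ c
      c-idem = idempotent-if-absorbs-f f≤c (cut-absorbs-f x)
      c·∼f²≡c : c · ∼ f² ≡ c
      c·∼f²≡c = ≡.trans (·-assoc x (∼ f²) (∼ f²)) (cong (x ·_) (idempotent-below-e ∼f²≤e))
      c≤f² : e ≤ x · ∼ c → c ≤ f²
      c≤f² e≤x∼c = begin
        c              ≡⟨ ≡.sym (·-idʳ c) ⟩
        c · e          ≤⟨ ·-monoʳ e≤x∼c ⟩
        c · (x · ∼ c)  ≡⟨ x∙yz≈y∙xz c x (∼ c) ⟩
        x · (c · ∼ c)  ≤⟨ ·-monoʳ (·∼-shrinks (≤-reflexive c-idem)) ⟩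
        x · ∼ c        ≤⟨ modus-ponens x f² ⟩
        f²             ∎
      f²≤f : e ≤ x · ∼ c → f² ≤ f A
      f²≤f e≤x∼c = begin
        f²             ≤⟨ ·-mono f≤c f≤c ⟩
        c · c          ≡⟨ c-idem ⟩
        c              ≡⟨ ≡.sym c·∼f²≡c ⟩
        c · ∼ f²       ≤⟨ ·-monoˡ (c≤f² e≤x∼c) ⟩
        f² · ∼ f²      ≤⟨ x·∼x≤f f² ⟩
        f A            ∎

  -- Above f², multiplication by f shrinks: either x ≤ f², so x = f² and
  -- f³ ≤ f² applies, or  e ≤ cut x,  so x = cut x, which absorbs f.
  ·f-shrinks : ∀ {x} → f² ≤ x → x · f A ≤ x
  ·f-shrinks {x} f²≤x with dichotomy x f²
  ... | inj₁ x≤f² = begin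
    x · f A      ≤⟨ ·-monoˡ x≤f² ⟩
    f² · f A     ≤⟨ f²·f≤f² ⟩
    f²           ≤⟨ f²≤x ⟩
    x            ∎
    where open ≤-Reasoning
  ... | inj₂ e≤cut = begin
    x · f A      ≤⟨ ·-monoˡ (cut-collapse e≤cut) ⟩
    cut x · f A  ≤⟨ cut-absorbs-f x ⟩
    cut x        ≤⟨ cut≤ x ⟩
    x            ∎
    where open ≤-Reasoning

  -- Above f², multiplication by f grows:  x ≤ x · f² = (x · f) · f ≤ x · f,
  -- the last step because x · f again lies above f².
  ·f-grows : ∀ {x} → f² ≤ x → x ≤ x · f A
  ·f-grows {x} f²≤x = begin
    x                  ≡⟨ ≡.sym (·-idʳ x) ⟩
    x · e              ≤⟨ ·-monoʳ e≤f² ⟩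
    x · f²             ≡⟨ ≡.sym (·-assoc x (f A) (f A)) ⟩
    (x · f A) · f A    ≤⟨ ·f-shrinks f²≤xf ⟩
    x · f A            ∎
    where
      open ≤-Reasoning
      f²≤xf : f² ≤ x · f A
      f²≤xf = begin
        f²         ≤⟨ ·-monoʳ f≤f² ⟩
        f A · f²   ≤⟨ ·-monoʳ f²≤x ⟩
        f A · x    ≡⟨ ·-comm (f A) x ⟩
        x · f A    ∎

  ·f-fixes : ∀ {x} → f² ≤ x → x · f A ≡ x
  ·f-fixes f²≤x = ≤-antisym (·f-shrinks f²≤x) (·f-grows f²≤x)

  idempotent-above-f² : ∀ {x} → f² ≤ x → x · x ≡ x
  idempotent-above-f² f²≤x = idempotent-if-absorbs-f (≤-trans f≤f² f²≤x) (·f-shrinks f²≤x)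

  comparable-with-f² : ∀ a → a ≤ f² ⊎ f² ≤ a
  comparable-with-f² = comparable-if-absorbs-f f²·f≤f²

  comparable-above-f² : ∀ {b} → f² ≤ b → ∀ a → a ≤ b ⊎ b ≤ a
  comparable-above-f² f²≤b = comparable-if-absorbs-f (·f-shrinks f²≤b)

  absorbs-below : ∀ {a b} → f A ≤ a → a ≤ b → f² ≤ b → a · b ≡ b
  absorbs-below {a} {b} f≤a a≤b f²≤b = ≤-antisym
    (≤-trans (·-monoˡ a≤b) (≤-reflexive (idempotent-above-f² f²≤b)))
    (begin
      b          ≡⟨ ≡.sym (·f-fixes f²≤b) ⟩
      b · f A    ≤⟨ ·-monoʳ f≤a ⟩
      b · a      ≡⟨ ·-comm b a ⟩
      a · b      ∎)
    where open ≤-Reasoning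

  ProductIsMax : Carrier → Carrier → Set
  ProductIsMax a b = (a ≤ b × a · b ≡ b) ⊎ (b ≤ a × a · b ≡ a)

  product-is-max-sym : ∀ {a b} → ProductIsMax a b → ProductIsMax b a
  product-is-max-sym {a} {b} =
    Sum.swap ∘ Sum.map (map₂ (≡.trans (·-comm b a))) (map₂ (≡.trans (·-comm b a)))

  product-is-max : ∀ {a b} → f A ≤ a → f² ≤ b → ProductIsMax a b
  product-is-max {a} {b} f≤a f²≤b = Sum.map
    (λ a≤b → a≤b , absorbs-below f≤a a≤b f²≤b)
    (λ b≤a → b≤a , ≡.trans (·-comm a b) (absorbs-below (≤-trans f≤f² f²≤b) b≤a (≤-trans f²≤b b≤a)))
    (comparable-above-f² f²≤b a)

  product-below-f² : ∀ {a b} → f A ≤ a → f A ≤ b → a ≤ f² × b ≤ f² → a · b ≡ f²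
  product-below-f² f≤a f≤b (a≤f² , b≤f²) =
    ≤-antisym (≤-trans (·-mono a≤f² b≤f²) (≤-reflexive f²-idempotent)) (·-mono f≤a f≤b)

  -- Second claim: if one of a, b is not below f², it lies above f².
  product-not-below-f² : ∀ {a b} → f A ≤ a → f A ≤ b → ¬ (a ≤ f² × b ≤ f²) → ProductIsMax a b
  product-not-below-f² {a} {b} f≤a f≤b not-below with comparable-with-f² a | comparable-with-f² b
  ... | _          | inj₂ f²≤b = product-is-max f≤a f²≤b
  ... | inj₂ f²≤a  | inj₁ _    = product-is-max-sym (product-is-max f≤b f²≤a)
  ... | inj₁ a≤f²  | inj₁ b≤f² = ⊥-elim (not-below (a≤f² , b≤f²))

  -- Above f², negation is absorbed by f:  f ⇒ b ≤ (f ⇒ b) · f² ≤ b · f ≤ b,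
  -- and negating gives  ¬b ≤ f · ¬b.
  ∼-grows : ∀ {b} → f² ≤ b → ∼ b ≤ f A · ∼ b
  ∼-grows {b} f²≤b = ≡.subst (∼ b ≤_) (∼∼ (f A · ∼ b)) (∼-antitone (begin
    f A ⇒ b                  ≡⟨ ≡.sym (·-idʳ (f A ⇒ b)) ⟩
    (f A ⇒ b) · e            ≤⟨ ·-monoʳ e≤f² ⟩
    (f A ⇒ b) · f²           ≡⟨ ≡.sym (·-assoc (f A ⇒ b) (f A) (f A)) ⟩
    ((f A ⇒ b) · f A) · f A  ≤⟨ ·-monoˡ (≡.subst (_≤ b) (·-comm (f A) (f A ⇒ b)) (modus-ponens (f A) b)) ⟩
    b · f A                  ≤⟨ ·f-shrinks f²≤b ⟩
    b                        ∎))
    where open ≤-Reasoning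

  ·∼-fixes : ∀ {a b} → f A ≤ a → a ≤ b → f² ≤ b → a · ∼ b ≡ ∼ b
  ·∼-fixes {a} {b} f≤a a≤b f²≤b = ≤-antisym
    (≤-trans (·-monoˡ a≤b) (·∼-shrinks (≤-reflexive (idempotent-above-f² f²≤b))))
    (≤-trans (∼-grows f²≤b) (·-monoˡ f≤a))

  -- Third claim, second part: by the dichotomy, either  b ≤ b · ¬a,  or
  -- e ≤ b · (b ⇒ a),  whence  b ≤ b · (b · (b ⇒ a)) = b · (b ⇒ a) ≤ a.
  ·∼-fixes-or-below : ∀ {a b} → f A ≤ a → f² ≤ b → b ≤ a ⊎ b · ∼ a ≡ b
  ·∼-fixes-or-below {a} {b} f≤a f²≤b = Sum.swap (Sum.map
    (≤-antisym (≡.subst (b · ∼ a ≤_) (·-idʳ b) (·-monoʳ (∼-below-e f≤a))))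
    b≤a
    (dichotomy b (b · ∼ a)))
    where
      open ≤-Reasoning
      b≤a : e ≤ b · (b ⇒ a) → b ≤ a
      b≤a e≤b·b⇒a = begin
        b                    ≡⟨ ≡.sym (·-idʳ b) ⟩
        b · e                ≤⟨ ·-monoʳ e≤b·b⇒a ⟩
        b · (b · (b ⇒ a))    ≡⟨ ≡.sym (·-assoc b b (b ⇒ a)) ⟩
        (b · b) · (b ⇒ a)    ≡⟨ cong (_· (b ⇒ a)) (idempotent-above-f² f²≤b) ⟩
        b · (b ⇒ a)          ≤⟨ modus-ponens b a ⟩
        a                    ∎

theorem5p18 : (A : IRL) → IsDeMorganMonoid A → IsFSI A → ¬ IsIdempotent A →
    let open IRL A in
    (a b : Carrier) → f A ≤ a → f A ≤ b →
      ((a ≤ _² A (f A) × b ≤ _² A (f A)) → a · b ≡ _² A (f A))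
      × (¬ (a ≤ _² A (f A) × b ≤ _² A (f A)) →
           (a ≤ b × a · b ≡ b) ⊎ (b ≤ a × a · b ≡ a))
      × ((_<_ A a b × _² A (f A) ≤ b) →
           (a · ∼ b ≡ ∼ b × b · ∼ b ≡ ∼ b) × b · ∼ a ≡ b)
theorem5p18 A dm fsi non-idempotent a b f≤a f≤b =
  product-below-f² f≤a f≤b , product-not-below-f² f≤a f≤b , negation-claims
  where
    open IRL A
    open IRLProperties A
    open NonIdempotentFSI A dm fsi non-idempotent
    negation-claims : (a ≤ b × a ≢ b) × f² ≤ b → (a · ∼ b ≡ ∼ b × b · ∼ b ≡ ∼ b) × b · ∼ a ≡ b
    negation-claims ((a≤b , a≢b) , f²≤b) =
      (·∼-fixes f≤a a≤b f²≤b , ·∼-fixes f≤b ≤-refl f²≤b)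
      , Sum.[ ⊥-elim ∘ a≢b ∘ ≤-antisym a≤b , id ]′ (·∼-fixes-or-below f≤a f²≤b)
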